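{- Let $\mathcal I$ be a $\frac32$-institution with a strict sentence functor. Let $(\varphi_k,i_k):(\Sigma_0,E_0)\to(\Sigma_k,E_k)$, $k=1,2$, be a span of theory changes, and let $\theta_k:\Sigma_k\to\Sigma$, $k=0,1,2$, be a near pushout of the underlying span $(\varphi_1,\varphi_2)$ of signature morphisms. Then for any $E\subseteq\mathit{Sen}(\Sigma)$, the theory changes $(\theta_k,\emptyset):(\Sigma_k,E_k)\to(\Sigma,E)$, $k=0,1,2$, constitute a near pushout cocone for the given span of theory changes.
   Context: A $\frac32$-institution has a $\frac32$-category of signatures $\mathit{Sign}$ (partially ordered hom-sets, monotone diagrammatic composition) and sentence sets $\mathit{Sen}(\Sigma)$ with partial functions $\mathit{Sen}(\varphi):\mathit{Sen}(\Sigma)\rightharpoonup\mathit{Sen}(\Sigma')$, monotone in $\varphi$ (graph inclusion); strict means $\mathit{Sen}(\varphi;\varphi')=\mathit{Sen}(\varphi);\mathit{Sen}(\varphi')$ and $\mathit{Sen}(1_\Sigma)=1$ (models and satisfaction are not used here). A theory is $(\Sigma,E)$, $E\subseteq\mathit{Sen}(\Sigma)$. A partial inclusion is a partial function consisting only of pairs $(a,a)$; $\emptyset$ denotes the empty partial inclusion. For $f:A\rightharpoonup B$, $A_1,A_2\subseteq A$, and a partial inclusion $i:A_1\rightharpoonup A_2$, $f(i)=\{(f(a),f(a))\mid a\in\mathrm{dom}(f),(a,a)\in i\}$. A theory change $(\varphi,i):(\Sigma,E)\to(\Sigma',E')$ is a signature morphism $\varphi:\Sigma\to\Sigma'$ together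 with a partial inclusion $i:\mathit{Sen}(\varphi)E\rightharpoonup E'$ (where $\mathit{Sen}(\varphi)E$ is the image). Theory changes form a $\frac32$-category with composition $(\varphi,i);(\theta,j)=(\varphi;\theta,\mathit{Sen}(\theta)(i);j)$ and order $(\varphi,i)\le(\varphi',i')$ iff $\varphi\le\varphi'$ and $i\subseteq i'$. In a $\frac32$-category, for a span $\varphi_1,\varphi_2$ with common domain, a lax cocone is $(\theta_0,\theta_1,\theta_2)$ with common codomain and $\varphi_k;\theta_k\le\theta_0$ ($k=1,2$). A lax cocone $\theta$ is a near pushout if for every lax cocone $\theta'$ of the same span the set $\{\mu\mid\theta_k;\mu\le\theta'_k,\ k=0,1,2\}$ has a maximal element. -}

module Defs where

open import Level using (Level; _⊔_; suc; Lift; lift)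
open import Data.Empty using (⊥)
open import Data.Product using (Σ; _×_; _,_; proj₁; proj₂)
open import Data.Maybe using (Maybe; just; nothing; _>>=_)
open import Relation.Binary.PropositionalEquality using (_≡_; refl; sym; trans)
open import Relation.Binary.Structures using (IsPartialOrder)

record Cat32Data (o h r : Level) : Set (suc (o ⊔ h ⊔ r)) where
  infixr 9 _⨾_
  infix 4 _≤_
  field
    Obj : Set o
    Hom : Obj → Obj → Set h
    _≤_ : ∀ {A B} → Hom A B → Hom A B → Set r
    _⨾_ : ∀ {A B C} → Hom A B → Hom B C → Hom A C

record Category32 (o h r : Level) : Set (suc (o ⊔ h ⊔ r)) where
  field
    cat : Cat32Data o h r
  open Cat32Data cat public
  field
    id       : ∀ {A} → Hom A A
    ≤-po     : ∀ {A B} → IsPartialOrder (_≡_ {A = Hom A B}) _≤_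
    ⨾-mono   : ∀ {A B C} {f f' : Hom A B} {g g' : Hom B C} →
               f ≤ f' → g ≤ g' → (f ⨾ g) ≤ (f' ⨾ g')
    ⨾-assoc  : ∀ {A B C D} (f : Hom A B) (g : Hom B C) (k : Hom C D) →
               ((f ⨾ g) ⨾ k) ≡ (f ⨾ (g ⨾ k))
    ⨾-idˡ    : ∀ {A B} (f : Hom A B) → (id ⨾ f) ≡ f
    ⨾-idʳ    : ∀ {A B} (f : Hom A B) → (f ⨾ id) ≡ f

module _ {o h r : Level} (C : Cat32Data o h r) where
  open Cat32Data C

  IsLaxCocone : ∀ {A B₁ B₂ D} (φ₁ : Hom A B₁) (φ₂ : Hom A B₂)
                (θ₀ : Hom A D) (θ₁ : Hom B₁ D) (θ₂ : Hom B₂ D) → Set r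
  IsLaxCocone φ₁ φ₂ θ₀ θ₁ θ₂ = ((φ₁ ⨾ θ₁) ≤ θ₀) × ((φ₂ ⨾ θ₂) ≤ θ₀)

  Mediating : ∀ {A B₁ B₂ D D'}
              (θ₀ : Hom A D) (θ₁ : Hom B₁ D) (θ₂ : Hom B₂ D)
              (θ'₀ : Hom A D') (θ'₁ : Hom B₁ D') (θ'₂ : Hom B₂ D') →
              Hom D D' → Set r
  Mediating θ₀ θ₁ θ₂ θ'₀ θ'₁ θ'₂ μ =
    ((θ₀ ⨾ μ) ≤ θ'₀) × ((θ₁ ⨾ μ) ≤ θ'₁) × ((θ₂ ⨾ μ) ≤ θ'₂)

  IsMaximal : ∀ {D D'} (P : Hom D D' → Set r) → Hom D D' → Set (h ⊔ r)
  IsMaximal P μ = P μ × (∀ μ' → P μ' → μ ≤ μ' → μ' ≤ μ)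

  IsNearPushout : ∀ {A B₁ B₂ D} (φ₁ : Hom A B₁) (φ₂ : Hom A B₂)
                  (θ₀ : Hom A D) (θ₁ : Hom B₁ D) (θ₂ : Hom B₂ D) →
                  Set (o ⊔ h ⊔ r)
  IsNearPushout {A} {B₁} {B₂} {D} φ₁ φ₂ θ₀ θ₁ θ₂ =
    IsLaxCocone φ₁ φ₂ θ₀ θ₁ θ₂ ×
    (∀ (D' : Obj) (θ'₀ : Hom A D') (θ'₁ : Hom B₁ D') (θ'₂ : Hom B₂ D') →
      IsLaxCocone φ₁ φ₂ θ'₀ θ'₁ θ'₂ →
      Σ (Hom D D') (IsMaximal (Mediating θ₀ θ₁ θ₂ θ'₀ θ'₁ θ'₂)))

-- 3/2-institutions (sentence part only; models/satisfaction unused).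
-- Partial functions A ⇀ B are represented as A → Maybe B.

record Inst32 (o h r s : Level) : Set (suc (o ⊔ h ⊔ r ⊔ s)) where
  field
    Sig : Category32 o h r
  open Category32 Sig public
  field
    Sen     : Obj → Set s
    sen     : ∀ {A B} → Hom A B → Sen A → Maybe (Sen B)
    sen-mono : ∀ {A B} {φ φ' : Hom A B} → φ ≤ φ' →
               ∀ a b → sen φ a ≡ just b → sen φ' a ≡ just b

record Strict {o h r s} (I : Inst32 o h r s) : Set (o ⊔ h ⊔ s) where
  open Inst32 I
  field
    sen-⨾  : ∀ {A B C} (φ : Hom A B) (θ : Hom B C) (a : Sen A) →
             sen (φ ⨾ θ) a ≡ (sen φ a >>= sen θ)
    sen-id : ∀ {A} (a : Sen A) → sen (id {A}) a ≡ just a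

module _ {o h r s : Level} (I : Inst32 o h r s) where
  open Inst32 I

  SenSet : Obj → Set (suc s)
  SenSet A = Sen A → Set s

  record Theory : Set (o ⊔ suc s) where
    constructor theory
    field
      sig : Obj
      ax  : SenSet sig

  open Theory public

  Image : ∀ {A B} → Hom A B → SenSet A → SenSet B
  Image {A} φ E b = Σ (Sen A) (λ a → E a × sen φ a ≡ just b)

  applyPI : ∀ {A B} → (Sen A → Maybe (Sen B)) → SenSet A → SenSet B
  applyPI {A} f i c = Σ (Sen A) (λ a → i a × f a ≡ just c)

  -- A theory change (φ, i) : (Σ, E) → (Σ', E'); the partial inclusion
  -- i : Sen(φ)E ⇀ E' is represented by its (common) domain/image,
  -- a subset of Sen(Σ') contained in both Sen(φ)E and E'.
  record TheoryChange (T T' : Theory) : Set (h ⊔ suc s) where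
    constructor change
    field
      mor     : Hom (sig T) (sig T')
      inc     : SenSet (sig T')
      inc-dom : ∀ b → inc b → Image mor (ax T) b
      inc-cod : ∀ b → inc b → ax T' b

  open TheoryChange public

  _≤TC_ : ∀ {T T'} → TheoryChange T T' → TheoryChange T T' → Set (r ⊔ s)
  c ≤TC c' = (mor c ≤ mor c') × (∀ b → inc c b → inc c' b)

  emptyChange : ∀ {T T'} → Hom (sig T) (sig T') → TheoryChange T T'
  emptyChange θ = change θ (λ _ → Lift _ ⊥) (λ _ ()) (λ _ ())

  module _ (strict : Strict I) where
    open Strict strict

    private
      bind-just : ∀ {X Y : Set s} (m : Maybe X) (x : X) (f : X → Maybe Y) →
                  m ≡ just x → (m >>= f) ≡ f x
      bind-just (just _) _ _ refl = refl

    -- (φ,i);(θ,j) = (φ;θ, Sen(θ)(i);j); composition of partial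
    -- inclusions is intersection.
    _⨾TC_ : ∀ {T T' T''} → TheoryChange T T' → TheoryChange T' T'' →
            TheoryChange T T''
    _⨾TC_ {T} c d = change (mor c ⨾ mor d)
      (λ x → applyPI (sen (mor d)) (inc c) x × inc d x)
      dom
      (λ x p → inc-cod d x (proj₂ p))
      where
      dom : ∀ x → applyPI (sen (mor d)) (inc c) x × inc d x →
            Image (mor c ⨾ mor d) (ax T) x
      dom x ((a , ia , eq) , _) with inc-dom c a ia
      ... | (e , Ee , eq') =
        e , Ee , trans (sen-⨾ (mor c) (mor d) e)
                       (trans (bind-just (sen (mor c) e) a (sen (mor d)) eq') eq)

    TheoryChanges : Cat32Data (o ⊔ suc s) (h ⊔ suc s) (r ⊔ s)
    TheoryChanges = record
      { Obj = Theory
      ; Hom = TheoryChange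
      ; _≤_ = _≤TC_
      ; _⨾_ = _⨾TC_
      }

module Submission where

-- A theory change whose partial inclusion is empty carries
-- no information beyond its signature morphism: composing it on either
-- side with another change again yields the empty inclusion, and it lies
-- below another change exactly when its signature morphism does.  Hence
-- the lax-cocone and mediating conditions for the cocone (θₖ, ∅) reduce to
-- the corresponding conditions on signature morphisms.  Given a lax cocone
-- of theory changes, its signature part is a lax cocone of the underlying
-- span, so the near pushout of signatures yields a maximal mediating
-- morphism μ.  Over μ we take the largest possible theory change, whose
-- inclusion is Sen(μ)E ∩ E'; by monotonicity of Sen every change over a
-- signature morphism below μ includes only sentences of that set, which
-- makes this change maximal among the mediating theory changes.

open import Defs
open import Level using (lower)
open import Data.Empty using (⊥-elim)
open import Data.Product using (Σ; _×_; _,_; proj₁; proj₂)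
open import Relation.Nullary using (¬_)

module TheoryChangeFacts {o h r s} (I : Inst32 o h r s) where
  open Inst32 I

  IsEmpty : ∀ {A} → SenSet I A → Set s
  IsEmpty X = ∀ b → ¬ X b

  emptyChange-isEmpty : ∀ {T T'} (θ : Hom (sig T) (sig T')) →
                        IsEmpty (inc (emptyChange I {T} {T'} θ))
  emptyChange-isEmpty θ b p = lower p

  isEmpty-≤TC : ∀ {T T'} (c c' : TheoryChange I T T') → IsEmpty (inc c) →
                mor c ≤ mor c' → _≤TC_ I c c'
  isEmpty-≤TC c c' empty le = le , λ b ib → ⊥-elim (empty b ib)

  largestChange : ∀ {T T'} → Hom (sig T) (sig T') → TheoryChange I T T'
  largestChange {T} {T'} μ =
    change μ (λ b → Image I μ (ax T) b × ax T' b) (λ _ → proj₁) (λ _ → proj₂)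

  -- Every change over a morphism below μ lies below the largest change
  -- over μ: a sentence Sen(mor c)(a) it includes is also Sen(μ)(a),
  -- since Sen is monotone in the morphism.
  ≤TC-largestChange : ∀ {T T'} (μ : Hom (sig T) (sig T')) (c : TheoryChange I T T') →
                      mor c ≤ μ → _≤TC_ I c (largestChange {T} {T'} μ)
  ≤TC-largestChange {T} {T'} μ c le = le , included
    where
    included : ∀ b → inc c b → inc (largestChange {T} {T'} μ) b
    included b ib with inc-dom c b ib
    ... | a , Ea , sen-a≡b = (a , Ea , sen-mono le a b sen-a≡b) , inc-cod c b ib

  module _ (strict : Strict I) where
    -- Composition intersects Sen(θ)(i) with j, so an empty inclusion on
    -- either side gives an empty inclusion of the composite.
    ⨾-isEmptyˡ : ∀ {T T' T''} (c : TheoryChange I T T') (d : TheoryChange I T' T'') →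
                 IsEmpty (inc c) → IsEmpty (inc (_⨾TC_ I strict c d))
    ⨾-isEmptyˡ c d empty b ((a , ia , _) , _) = empty a ia

    ⨾-isEmptyʳ : ∀ {T T' T''} (c : TheoryChange I T T') (d : TheoryChange I T' T'') →
                 IsEmpty (inc d) → IsEmpty (inc (_⨾TC_ I strict c d))
    ⨾-isEmptyʳ c d empty b (_ , jb) = empty b jb

    ⨾-emptyChange-≤TC : ∀ {T T' T''} (c : TheoryChange I T T') (θ : Hom (sig T') (sig T''))
                        (d : TheoryChange I T T'') → (mor c ⨾ θ) ≤ mor d →
                        _≤TC_ I (_⨾TC_ I strict c (emptyChange I {T'} {T''} θ)) d
    ⨾-emptyChange-≤TC {T} {T'} {T''} c θ d =
      isEmpty-≤TC (_⨾TC_ I strict c (emptyChange I {T'} {T''} θ)) d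
        (⨾-isEmptyʳ c (emptyChange I {T'} {T''} θ) (emptyChange-isEmpty {T'} {T''} θ))

    emptyChange-⨾-≤TC : ∀ {T T' T''} (θ : Hom (sig T) (sig T')) (c : TheoryChange I T' T'')
                        (d : TheoryChange I T T'') → (θ ⨾ mor c) ≤ mor d →
                        _≤TC_ I (_⨾TC_ I strict (emptyChange I {T} {T'} θ) c) d
    emptyChange-⨾-≤TC {T} {T'} θ c d =
      isEmpty-≤TC (_⨾TC_ I strict (emptyChange I {T} {T'} θ) c) d
        (⨾-isEmptyˡ (emptyChange I {T} {T'} θ) c (emptyChange-isEmpty {T} {T'} θ))

open TheoryChangeFacts

mainTheorem16 : ∀ {o h r s} (I : Inst32 o h r s) (strict : Strict I) →
    let open Inst32 I in
    (T₀ T₁ T₂ : Theory I)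
    (c₁ : TheoryChange I T₀ T₁) (c₂ : TheoryChange I T₀ T₂)
    (Σ' : Obj) (θ₀ : Hom (sig T₀) Σ') (θ₁ : Hom (sig T₁) Σ')
    (θ₂ : Hom (sig T₂) Σ') →
    IsNearPushout cat (mor c₁) (mor c₂) θ₀ θ₁ θ₂ →
    (E : SenSet I Σ') →
    IsNearPushout (TheoryChanges I strict) c₁ c₂
    (emptyChange I {T₀} {theory Σ' E} θ₀)
    (emptyChange I {T₁} {theory Σ' E} θ₁)
    (emptyChange I {T₂} {theory Σ' E} θ₂)
mainTheorem16 I strict T₀ T₁ T₂ c₁ c₂ Σ' θ₀ θ₁ θ₂ ((lax₁ , lax₂) , nearPushout) E =
  ( ⨾-emptyChange-≤TC I strict c₁ θ₁ (∅ θ₀) lax₁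
  , ⨾-emptyChange-≤TC I strict c₂ θ₂ (∅ θ₀) lax₂ ) ,
  mediator
  where
  open Inst32 I
  C : Cat32Data _ _ _
  C = TheoryChanges I strict

  ∅ : ∀ {T'} → Hom (sig T') Σ' → TheoryChange I T' (theory Σ' E)
  ∅ {T'} θ = emptyChange I {T'} {theory Σ' E} θ

  -- The signature part of a lax cocone of theory changes is a lax cocone
  -- of signatures; the largest change over its maximal mediating morphism
  -- μ mediates, and any mediating change above it has morphism ≤ μ.
  mediator : ∀ (D : Theory I) (t₀ : TheoryChange I T₀ D) (t₁ : TheoryChange I T₁ D)
             (t₂ : TheoryChange I T₂ D) → IsLaxCocone C c₁ c₂ t₀ t₁ t₂ →
             Σ (TheoryChange I (theory Σ' E) D)
               (IsMaximal C (Mediating C (∅ θ₀) (∅ θ₁) (∅ θ₂) t₀ t₁ t₂))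
  mediator D t₀ t₁ t₂ ((l₁ , _) , (l₂ , _))
    with nearPushout (sig D) (mor t₀) (mor t₁) (mor t₂) (l₁ , l₂)
  ... | μ , (m₀ , m₁ , m₂) , μ-maximal =
    m ,
    ( emptyChange-⨾-≤TC I strict θ₀ m t₀ m₀
    , emptyChange-⨾-≤TC I strict θ₁ m t₁ m₁
    , emptyChange-⨾-≤TC I strict θ₂ m t₂ m₂ ) ,
    λ { m' ((n₀ , _) , (n₁ , _) , (n₂ , _)) (μ≤m' , _) →
          ≤TC-largestChange I μ m' (μ-maximal (mor m') (n₀ , n₁ , n₂) μ≤m') }
    where
    m : TheoryChange I (theory Σ' E) D
    m = largestChange I μ
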